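{- The set of idempotents $P(M)$ of an effect monoid $M$ is a Boolean algebra. Thus an effect monoid is Boolean iff it is a Boolean algebra.
   Context: An effect algebra is a set $E$ with an element $0$, a partial binary operation $a+b$ (the partial sum), and a total complement $a\mapsto a^\perp$, such that: the sum is commutative and associative wherever defined, $a+0=a$, $a^\perp$ is the unique element with $a+a^\perp=1$ where $1:=0^\perp$, and $a+1$ defined implies $a=0$. The order is $a\le b$ iff $b=a+c$ for some $c$. An effect monoid is an effect algebra with an associative total multiplication $\cdot$ with unit $1$ which distributes over the partial sum on both sides. $P(M)$ is the set of $p\in M$ with $p\cdot p=p$, with the order and complement inherited from $M$. An effect monoid is Boolean when every element $b\le 1$ (i.e. every element) is idempotent. A Boolean algebra is regarded as an effect monoid with $x+y$ defined iff $x\wedge y=0$ (then equal to $x\vee y$) and product $x\wedge y$. -}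

module Defs where

open import Level using (Level; suc; _⊔_)
open import Data.Maybe using (Maybe; just; nothing)
open import Data.Product using (Σ; ∃; _×_; _,_; proj₁; proj₂)
open import Relation.Binary.PropositionalEquality using (_≡_)
open import Relation.Nullary using (¬_)
open import Algebra.Lattice.Structures using (IsBooleanAlgebra)

-- Effect algebra.  The partial sum a + b is modelled as  a ⊕ b : Maybe E,
-- with  a ⊕ b ≡ nothing  meaning "undefined".
record EffectAlgebra (a : Level) : Set (suc a) where
  infixl 6 _⊕_
  field
    Carrier : Set a
    𝟘       : Carrier
    _⊕_     : Carrier → Carrier → Maybe Carrier
    _ᗮ      : Carrier → Carrier

  𝟙 : Carrier
  𝟙 = 𝟘 ᗮ

  field
    ⊕-comm   : ∀ x y → x ⊕ y ≡ y ⊕ x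
    ⊕-assoc  : ∀ x y z d e → x ⊕ y ≡ just d → d ⊕ z ≡ just e →
               Σ Carrier (λ f → (y ⊕ z ≡ just f) × (x ⊕ f ≡ just e))
    ⊕-zero   : ∀ x → x ⊕ 𝟘 ≡ just x
    ᗮ-sum    : ∀ x → x ⊕ (x ᗮ) ≡ just 𝟙
    ᗮ-unique : ∀ x y → x ⊕ y ≡ just 𝟙 → y ≡ x ᗮ
    zero-one : ∀ x y → x ⊕ 𝟙 ≡ just y → x ≡ 𝟘

  _≤_ : Carrier → Carrier → Set a
  x ≤ y = Σ Carrier (λ c → x ⊕ c ≡ just y)

record EffectMonoid (a : Level) : Set (suc a) where
  field
    effectAlgebra : EffectAlgebra a
  open EffectAlgebra effectAlgebra public
  infixl 7 _·_
  field
    _·_      : Carrier → Carrier → Carrier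
    ·-assoc  : ∀ x y z → (x · y) · z ≡ x · (y · z)
    ·-unitˡ  : ∀ x → 𝟙 · x ≡ x
    ·-unitʳ  : ∀ x → x · 𝟙 ≡ x
    distribˡ : ∀ x y z s → y ⊕ z ≡ just s → (x · y) ⊕ (x · z) ≡ just (x · s)
    distribʳ : ∀ x y z s → y ⊕ z ≡ just s → (y · x) ⊕ (z · x) ≡ just (s · x)

module _ {a : Level} (M : EffectMonoid a) where
  open EffectMonoid M

  IsIdempotent : Carrier → Set a
  IsIdempotent p = p · p ≡ p

  P : Set a
  P = Σ Carrier IsIdempotent

  _≈P_ : P → P → Set a
  p ≈P q = proj₁ p ≡ proj₁ q

  PIsBooleanAlgebra : Set a
  PIsBooleanAlgebra =
    Σ (IsIdempotent 𝟘) λ idem0 →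
    Σ (IsIdempotent 𝟙) λ idem1 →
    Σ (∀ p → IsIdempotent p → IsIdempotent (p ᗮ)) λ idemᗮ →
    Σ (P → P → P) λ _∨_ →
    Σ (P → P → P) λ _∧_ →
      IsBooleanAlgebra _≈P_ _∨_ _∧_
        (λ p → (proj₁ p ᗮ , idemᗮ (proj₁ p) (proj₂ p)))
        (𝟙 , idem1) (𝟘 , idem0)
      × (∀ p q → (proj₁ p ≤ proj₁ q → (p ∧ q) ≈P p)
               × ((p ∧ q) ≈P p → proj₁ p ≤ proj₁ q))

  IsBoolean : Set a
  IsBoolean = ∀ x → IsIdempotent x

  IsBooleanAlgebraEM : Set a
  IsBooleanAlgebraEM =
    Σ (Carrier → Carrier → Carrier) λ _∨_ →
    Σ (Carrier → Carrier → Carrier) λ _∧_ →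
    Σ (Carrier → Carrier) λ ¬′ →
    Σ Carrier λ ⊤ →
    Σ Carrier λ ⊥ →
      IsBooleanAlgebra _≡_ _∨_ _∧_ ¬′ ⊤ ⊥
      × (∀ x y → x ∧ y ≡ ⊥ → x ⊕ y ≡ just (x ∨ y))
      × (∀ x y → ¬ (x ∧ y ≡ ⊥) → x ⊕ y ≡ nothing)
      × (∀ x y → x · y ≡ x ∧ y)
      × (𝟘 ≡ ⊥)
      × (∀ x → x ᗮ ≡ ¬′ x)

-- For an idempotent p every element below p is fixed by p on
-- both sides, since p ᗮ annihilates it.  Consequently idempotents are
-- central: x · q and x · q ᗮ lie below q and q ᗮ respectively, which forces
-- q · x · q = x · q and q · x · q ᗮ = 0.  Idempotents are therefore closed
-- under products, so on P(M) the product is a meet; the join is defined by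
-- De Morgan, p ∨ q = (p ᗮ · q ᗮ) ᗮ.  The remaining lattice laws are short
-- computations, except distributivity, which rests on the effect-algebra
-- identity (x · y) ᗮ = x · y ᗮ + x ᗮ.  The order of M restricted to P(M)
-- is the lattice order because x · q = x iff x ≤ q for idempotent q.
--
-- When M is Boolean, P(M) is all of M, and an
-- orthogonal pair of idempotents has its join as sum, which gives the
-- remaining structure; conversely, meets in a Boolean algebra are idempotent.

module Submission where

open import Defs
open import Level using (Level)
open import Data.Product using (_×_; Σ; _,_; proj₁; proj₂)
open import Data.Maybe using (just; nothing)
open import Data.Maybe.Properties using (just-injective)
open import Data.Empty using (⊥-elim)
open import Relation.Nullary using (¬_)
open import Relation.Binary.PropositionalEquality
open import Algebra.Lattice.Structures using (IsBooleanAlgebra)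
open import Algebra.Lattice.Structures.Biased using (isDistributiveLatticeʳʲᵐ; isBooleanAlgebraʳ)
open import Algebra.Lattice.Bundles using (Lattice)
import Algebra.Lattice.Properties.Lattice as LatticeProperties

module EffectAlgebraFacts {a : Level} (E : EffectAlgebra a) where
  open EffectAlgebra E

  ⊕-identityˡ : ∀ x → 𝟘 ⊕ x ≡ just x
  ⊕-identityˡ x = trans (⊕-comm 𝟘 x) (⊕-zero x)

  drop-zeroˡ : ∀ {u v w} → u ⊕ v ≡ just w → u ≡ 𝟘 → v ≡ w
  drop-zeroˡ {v = v} s refl = just-injective (trans (sym (⊕-identityˡ v)) s)

  drop-zeroʳ : ∀ {u v w} → u ⊕ v ≡ just w → v ≡ 𝟘 → u ≡ w
  drop-zeroʳ {u} s refl = just-injective (trans (sym (⊕-zero u)) s)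

  ⊕-assocʳ : ∀ {x y z f e} → x ⊕ f ≡ just e → y ⊕ z ≡ just f →
             Σ Carrier (λ d → (x ⊕ y ≡ just d) × (d ⊕ z ≡ just e))
  ⊕-assocʳ {x} {y} {z} {f} {e} xf yz
    with ⊕-assoc z y x f e (trans (⊕-comm z y) yz) (trans (⊕-comm f x) xf)
  ... | d , yx , zd = d , trans (⊕-comm x y) yx , trans (⊕-comm d z) zd

  ᗮ-involutive : ∀ x → x ᗮ ᗮ ≡ x
  ᗮ-involutive x = sym (ᗮ-unique (x ᗮ) x (trans (⊕-comm (x ᗮ) x) (ᗮ-sum x)))

  complement-of-sum : ∀ {x y c} → x ⊕ y ≡ just c → y ⊕ (c ᗮ) ≡ just (x ᗮ)
  complement-of-sum {x} {y} {c} xy with ⊕-assoc x y (c ᗮ) c 𝟙 xy (ᗮ-sum c)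
  ... | f , ycᗮ , xf = subst (λ w → y ⊕ (c ᗮ) ≡ just w) (ᗮ-unique x f xf) ycᗮ

  -- Cancellation: complementing d = x + y and d = x + z gives x + d ᗮ = y ᗮ = z ᗮ.
  ⊕-cancelˡ : ∀ {x y z d} → x ⊕ y ≡ just d → x ⊕ z ≡ just d → y ≡ z
  ⊕-cancelˡ {x} {y} {z} xy xz = begin
    y         ≡⟨ ᗮ-involutive y ⟨
    y ᗮ ᗮ     ≡⟨ cong _ᗮ (just-injective (trans (sym (x+dᗮ xy)) (x+dᗮ xz))) ⟩
    z ᗮ ᗮ     ≡⟨ ᗮ-involutive z ⟩
    z         ∎
    where
    open ≡-Reasoning
    x+dᗮ : ∀ {u d} → x ⊕ u ≡ just d → x ⊕ (d ᗮ) ≡ just (u ᗮ)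
    x+dᗮ {u} xu = complement-of-sum (trans (⊕-comm u x) xu)

  ⊕-self⇒zero : ∀ {x y} → x ⊕ y ≡ just x → y ≡ 𝟘
  ⊕-self⇒zero {x} xy = ⊕-cancelˡ xy (⊕-zero x)

  ⊕-positive : ∀ {x y} → x ⊕ y ≡ just 𝟘 → x ≡ 𝟘
  ⊕-positive {x} {y} xy with ⊕-assoc x y 𝟙 𝟘 𝟙 xy (⊕-identityˡ 𝟙)
  ... | f , y1 , _ with zero-one y f y1
  ... | refl = drop-zeroʳ xy refl

  complement-via : ∀ {a b x c} → a ⊕ b ≡ just x → a ⊕ (x ᗮ) ≡ just c → b ≡ c ᗮ
  complement-via {b = b} {x} ab axᗮ =
    ⊕-cancelˡ (trans (⊕-comm (x ᗮ) b) (complement-of-sum ab)) (complement-of-sum axᗮ)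

  complement-shift : ∀ {x y w} → y ⊕ w ≡ just (x ᗮ) → x ⊕ y ≡ just (w ᗮ)
  complement-shift {x} {y} {w} yw with ⊕-assocʳ (ᗮ-sum x) yw
  ... | d , xy , dw = trans xy (cong just (ᗮ-unique w d (trans (⊕-comm w d) dw)))

module EffectMonoidFacts {a : Level} (M : EffectMonoid a) where
  open EffectMonoid M
  open EffectAlgebraFacts effectAlgebra

  splitˡ : ∀ x a → (x · a) ⊕ (x · (a ᗮ)) ≡ just x
  splitˡ x a = trans (distribˡ x a (a ᗮ) 𝟙 (ᗮ-sum a)) (cong just (·-unitʳ x))

  splitʳ : ∀ x a → (a · x) ⊕ ((a ᗮ) · x) ≡ just x
  splitʳ x a = trans (distribʳ x a (a ᗮ) 𝟙 (ᗮ-sum a)) (cong just (·-unitˡ x))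

  ·-zeroˡ : ∀ x → 𝟘 · x ≡ 𝟘
  ·-zeroˡ x = ⊕-self⇒zero (distribʳ x 𝟘 𝟘 𝟘 (⊕-zero 𝟘))

  ·-stableʳ : ∀ {x a} → x · (a ᗮ) ≡ 𝟘 → x · a ≡ x
  ·-stableʳ {x} {a} = drop-zeroʳ (splitˡ x a)

  ·ᗮ-stableʳ : ∀ {x a} → x · a ≡ 𝟘 → x · (a ᗮ) ≡ x
  ·ᗮ-stableʳ {x} {a} = drop-zeroˡ (splitˡ x a)

  ·-stableˡ : ∀ {x a} → (a ᗮ) · x ≡ 𝟘 → a · x ≡ x
  ·-stableˡ {x} {a} = drop-zeroʳ (splitʳ x a)

  ·-below : ∀ x q → (x · q) ≤ q
  ·-below x q = (x ᗮ) · q , splitʳ q x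

  -- The key identity behind distributivity: (x · y) ᗮ = x · y ᗮ + x ᗮ.
  complement-of-product : ∀ x y → (x · (y ᗮ)) ⊕ (x ᗮ) ≡ just ((x · y) ᗮ)
  complement-of-product x y = complement-of-sum (splitˡ x y)

  module Idempotent {p : Carrier} (p-idem : IsIdempotent M p) where

    ·ᗮ-zero : p · (p ᗮ) ≡ 𝟘
    ·ᗮ-zero = ⊕-self⇒zero (subst (λ w → w ⊕ (p · (p ᗮ)) ≡ just p) p-idem (splitˡ p p))

    ᗮ·-zero : (p ᗮ) · p ≡ 𝟘
    ᗮ·-zero = ⊕-self⇒zero (subst (λ w → w ⊕ ((p ᗮ) · p) ≡ just p) p-idem (splitʳ p p))

    ᗮ-idem : IsIdempotent M (p ᗮ)
    ᗮ-idem = ·ᗮ-stableʳ ᗮ·-zero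

    ᗮ·-annihilates : ∀ y → (p ᗮ) · (p · y) ≡ 𝟘
    ᗮ·-annihilates y = trans (sym (·-assoc (p ᗮ) p y)) (trans (cong (_· y) ᗮ·-zero) (·-zeroˡ y))

    ·-annihilatesᗮ : ∀ y → p · ((p ᗮ) · y) ≡ 𝟘
    ·-annihilatesᗮ y = trans (sym (·-assoc p (p ᗮ) y)) (trans (cong (_· y) ·ᗮ-zero) (·-zeroˡ y))

    -- An element below p is fixed by p on both sides, because p ᗮ kills it.
    below⇒fixed : ∀ {x} → x ≤ p → (p · x ≡ x) × (x · p ≡ x)
    below⇒fixed {x} (c , xc) =
        ·-stableˡ (⊕-positive (trans (distribˡ (p ᗮ) x c p xc) (cong just ᗮ·-zero)))
      , ·-stableʳ (⊕-positive (trans (distribʳ (p ᗮ) x c p xc) (cong just ·ᗮ-zero)))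

  open Idempotent

  ᗮ-fixed⇒zero : ∀ {x a} → (a ᗮ) · x ≡ x → a · x ≡ 𝟘
  ᗮ-fixed⇒zero {x} {a} e =
    ⊕-self⇒zero (trans (⊕-comm x (a · x)) (subst (λ w → (a · x) ⊕ w ≡ just x) e (splitʳ x a)))

  -- Idempotents are central: q · x · q ᗮ = 0 because x · q ᗮ lies below q ᗮ,
  -- hence q · x = q · x · q, and q · x · q = x · q because x · q lies below q.
  idempotent-central : ∀ {q} → IsIdempotent M q → ∀ x → q · x ≡ x · q
  idempotent-central {q} q-idem x = begin
    q · x         ≡⟨ ·-stableʳ qxqᗮ≡0 ⟨
    (q · x) · q   ≡⟨ ·-assoc q x q ⟩
    q · (x · q)   ≡⟨ proj₁ (below⇒fixed q-idem (·-below x q)) ⟩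
    x · q         ∎
    where
    open ≡-Reasoning
    qxqᗮ≡0 : (q · x) · (q ᗮ) ≡ 𝟘
    qxqᗮ≡0 = trans (·-assoc q x (q ᗮ)) (ᗮ-fixed⇒zero (proj₁ (below⇒fixed (ᗮ-idem q-idem) (·-below x (q ᗮ)))))

  infixr 6 _∨_
  _∨_ : Carrier → Carrier → Carrier
  x ∨ y = ((x ᗮ) · (y ᗮ)) ᗮ

  ·-idem : ∀ {x y} → IsIdempotent M x → IsIdempotent M y → IsIdempotent M (x · y)
  ·-idem {x} {y} x-idem y-idem = begin
    (x · y) · (x · y)   ≡⟨ ·-assoc x y (x · y) ⟩
    x · (y · (x · y))   ≡⟨ cong (x ·_) (·-assoc y x y) ⟨
    x · ((y · x) · y)   ≡⟨ cong (λ w → x · (w · y)) (idempotent-central x-idem y) ⟨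
    x · ((x · y) · y)   ≡⟨ cong (x ·_) (·-assoc x y y) ⟩
    x · (x · (y · y))   ≡⟨ ·-assoc x x (y · y) ⟨
    (x · x) · (y · y)   ≡⟨ cong₂ _·_ x-idem y-idem ⟩
    x · y               ∎
    where open ≡-Reasoning

  ∨-idem : ∀ {x y} → IsIdempotent M x → IsIdempotent M y → IsIdempotent M (x ∨ y)
  ∨-idem x-idem y-idem = ᗮ-idem (·-idem (ᗮ-idem x-idem) (ᗮ-idem y-idem))

  ∨-comm : ∀ {x} → IsIdempotent M x → ∀ y → x ∨ y ≡ y ∨ x
  ∨-comm x-idem y = cong _ᗮ (idempotent-central (ᗮ-idem x-idem) (y ᗮ))

  ∨-assoc : ∀ x y z → (x ∨ y) ∨ z ≡ x ∨ (y ∨ z)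
  ∨-assoc x y z = cong _ᗮ (begin
    (x ∨ y) ᗮ · (z ᗮ)            ≡⟨ cong (_· (z ᗮ)) (ᗮ-involutive ((x ᗮ) · (y ᗮ))) ⟩
    ((x ᗮ) · (y ᗮ)) · (z ᗮ)      ≡⟨ ·-assoc (x ᗮ) (y ᗮ) (z ᗮ) ⟩
    (x ᗮ) · ((y ᗮ) · (z ᗮ))      ≡⟨ cong ((x ᗮ) ·_) (ᗮ-involutive ((y ᗮ) · (z ᗮ))) ⟨
    (x ᗮ) · (y ∨ z) ᗮ            ∎)
    where open ≡-Reasoning

  ∨-absorbs-· : ∀ {x} → IsIdempotent M x → ∀ y → x ∨ (x · y) ≡ x
  ∨-absorbs-· {x} x-idem y =
    trans (cong _ᗮ (·ᗮ-stableʳ (ᗮ·-annihilates x-idem y))) (ᗮ-involutive x)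

  ·-absorbs-∨ : ∀ {x} → IsIdempotent M x → ∀ y → x · (x ∨ y) ≡ x
  ·-absorbs-∨ x-idem y = ·ᗮ-stableʳ (·-annihilatesᗮ x-idem (y ᗮ))

  ∨-complementʳ : ∀ {x} → IsIdempotent M x → x ∨ (x ᗮ) ≡ 𝟙
  ∨-complementʳ {x} x-idem = cong _ᗮ (trans (cong ((x ᗮ) ·_) (ᗮ-involutive x)) (ᗮ·-zero x-idem))

  -- With
  -- s = y ᗮ · z ᗮ we have x = x · s + x · s ᗮ, and the complement identity
  -- for products shows x · s + x ᗮ = (x · y) ᗮ · (x · z) ᗮ; hence x · s ᗮ is
  -- the complement of the latter, which is (x · y) ∨ (x · z).
  ·-distribˡ-∨ : ∀ {x} → IsIdempotent M x → ∀ y z → x · (y ∨ z) ≡ (x · y) ∨ (x · z)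
  ·-distribˡ-∨ {x} x-idem y z = complement-via (splitˡ x s) xs+xᗮ
    where
    s = (y ᗮ) · (z ᗮ)
    -- (x · a) · (x · b) = x · (a · b), as x is a central idempotent.
    merge : ∀ a b → (x · a) · (x · b) ≡ x · (a · b)
    merge a b = begin
      (x · a) · (x · b)   ≡⟨ ·-assoc x a (x · b) ⟩
      x · (a · (x · b))   ≡⟨ cong (x ·_) (·-assoc a x b) ⟨
      x · ((a · x) · b)   ≡⟨ cong (λ w → x · (w · b)) (idempotent-central x-idem a) ⟨
      x · ((x · a) · b)   ≡⟨ cong (x ·_) (·-assoc x a b) ⟩
      x · (x · (a · b))   ≡⟨ ·-assoc x x (a · b) ⟨
      (x · x) · (a · b)   ≡⟨ cong (_· (a · b)) x-idem ⟩
      x · (a · b)         ∎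
      where open ≡-Reasoning
    -- (x · a) · x ᗮ = 0, as x ᗮ is central and annihilated by x.
    kill : ∀ a → (x · a) · (x ᗮ) ≡ 𝟘
    kill a = begin
      (x · a) · (x ᗮ)     ≡⟨ ·-assoc x a (x ᗮ) ⟩
      x · (a · (x ᗮ))     ≡⟨ cong (x ·_) (idempotent-central (ᗮ-idem x-idem) a) ⟨
      x · ((x ᗮ) · a)     ≡⟨ ·-annihilatesᗮ x-idem a ⟩
      𝟘                   ∎
      where open ≡-Reasoning
    -- (x · y ᗮ) · (x · z) ᗮ = x · s, expanding (x · z) ᗮ = x · z ᗮ + x ᗮ.
    first-summand : (x · (y ᗮ)) · ((x · z) ᗮ) ≡ x · s
    first-summand =
      trans (sym (drop-zeroʳ (distribˡ (x · (y ᗮ)) _ _ _ (complement-of-product x z)) (kill (y ᗮ))))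
            (merge (y ᗮ) (z ᗮ))
    second-summand : (x ᗮ) · ((x · z) ᗮ) ≡ x ᗮ
    second-summand = ·ᗮ-stableʳ (ᗮ·-annihilates x-idem z)
    xs+xᗮ : (x · s) ⊕ (x ᗮ) ≡ just (((x · y) ᗮ) · ((x · z) ᗮ))
    xs+xᗮ = subst₂ (λ u v → u ⊕ v ≡ just (((x · y) ᗮ) · ((x · z) ᗮ))) first-summand second-summand
              (distribʳ ((x · z) ᗮ) _ _ _ (complement-of-product x y))

  ∨-distribʳ-· : ∀ {x} → IsIdempotent M x → ∀ y z → (y · z) ∨ x ≡ (y ∨ x) · (z ∨ x)
  ∨-distribʳ-· {x} x-idem y z = begin
    ((y · z) ᗮ · (x ᗮ)) ᗮ                        ≡⟨ cong _ᗮ (xᗮ-central ((y · z) ᗮ)) ⟨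
    ((x ᗮ) · (y · z) ᗮ) ᗮ                        ≡⟨ cong (λ w → ((x ᗮ) · w) ᗮ) product-as-join ⟩
    ((x ᗮ) · ((y ᗮ) ∨ (z ᗮ))) ᗮ                  ≡⟨ cong _ᗮ (·-distribˡ-∨ (ᗮ-idem x-idem) (y ᗮ) (z ᗮ)) ⟩
    ((x ᗮ) · (y ᗮ) ∨ (x ᗮ) · (z ᗮ)) ᗮ            ≡⟨ ᗮ-involutive _ ⟩
    ((x ᗮ) · (y ᗮ)) ᗮ · ((x ᗮ) · (z ᗮ)) ᗮ        ≡⟨ cong₂ (λ u v → u ᗮ · v ᗮ) (xᗮ-central (y ᗮ)) (xᗮ-central (z ᗮ)) ⟩
    (y ∨ x) · (z ∨ x)                            ∎
    where
    open ≡-Reasoning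
    xᗮ-central : ∀ w → (x ᗮ) · w ≡ w · (x ᗮ)
    xᗮ-central = idempotent-central (ᗮ-idem x-idem)
    product-as-join : (y · z) ᗮ ≡ (y ᗮ) ∨ (z ᗮ)
    product-as-join = cong _ᗮ (sym (cong₂ _·_ (ᗮ-involutive y) (ᗮ-involutive z)))

  below-idempotent⇔ : ∀ {x q} → IsIdempotent M q → (x ≤ q → x · q ≡ x) × (x · q ≡ x → x ≤ q)
  below-idempotent⇔ {x} {q} q-idem =
    (λ x≤q → proj₂ (below⇒fixed q-idem x≤q)) , (λ e → subst (_≤ q) e (·-below x q))

  _∨P_ : P M → P M → P M
  (x , x-idem) ∨P (y , y-idem) = x ∨ y , ∨-idem x-idem y-idem

  _∧P_ : P M → P M → P M
  (x , x-idem) ∧P (y , y-idem) = x · y , ·-idem x-idem y-idem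

  ¬P : P M → P M
  ¬P (x , x-idem) = x ᗮ , ᗮ-idem x-idem

  P-isBooleanAlgebra : IsBooleanAlgebra (_≈P_ M) _∨P_ _∧P_ ¬P (𝟙 , ·-unitˡ 𝟙) (𝟘 , ·-zeroˡ 𝟘)
  P-isBooleanAlgebra = isBooleanAlgebraʳ record
    { isDistributiveLattice = isDistributiveLatticeʳʲᵐ record
      { isLattice = record
        { isEquivalence = record { refl = refl ; sym = sym ; trans = trans }
        ; ∨-comm        = λ (_ , x-idem) (y , _) → ∨-comm x-idem y
        ; ∨-assoc       = λ (x , _) (y , _) (z , _) → ∨-assoc x y z
        ; ∨-cong        = cong₂ _∨_
        ; ∧-comm        = λ (_ , x-idem) (y , _) → idempotent-central x-idem y
        ; ∧-assoc       = λ (x , _) (y , _) (z , _) → ·-assoc x y z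
        ; ∧-cong        = cong₂ _·_
        ; absorptive    = (λ (_ , x-idem) (y , _) → ∨-absorbs-· x-idem y)
                        , (λ (_ , x-idem) (y , _) → ·-absorbs-∨ x-idem y)
        }
      ; ∨-distribʳ-∧ = λ (_ , x-idem) (y , _) (z , _) → ∨-distribʳ-· x-idem y z
      }
    ; ∨-complementʳ = λ (_ , x-idem) → ∨-complementʳ x-idem
    ; ∧-complementʳ = λ (_ , x-idem) → ·ᗮ-zero x-idem
    ; ¬-cong        = cong _ᗮ
    }

  P-order : ∀ p q → (proj₁ p ≤ proj₁ q → _≈P_ M (p ∧P q) p) × (_≈P_ M (p ∧P q) p → proj₁ p ≤ proj₁ q)
  P-order _ (_ , q-idem) = below-idempotent⇔ q-idem

  P-isBooleanAlgebraM : PIsBooleanAlgebra M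
  P-isBooleanAlgebraM =
    ·-zeroˡ 𝟘 , ·-unitˡ 𝟙 , (λ _ → ᗮ-idem) , _∨P_ , _∧P_ , P-isBooleanAlgebra , P-order

  -- A defined sum x + y with x idempotent is an orthogonal pair:
  -- y ≤ x ᗮ, so x · y = x · (x ᗮ · y) = 0.
  sum⇒orthogonal : ∀ {x y d} → IsIdempotent M x → x ⊕ y ≡ just d → x · y ≡ 𝟘
  sum⇒orthogonal {x} {y} {d} x-idem xy = begin
    x · y                ≡⟨ cong (x ·_) (proj₁ (below⇒fixed (ᗮ-idem x-idem) (d ᗮ , complement-of-sum xy))) ⟨
    x · ((x ᗮ) · y)      ≡⟨ ·-annihilatesᗮ x-idem y ⟩
    𝟘                    ∎
    where open ≡-Reasoning

  -- Conversely, an orthogonal pair with x idempotent has x + y = x ∨ y: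
  -- from y · x = 0 we get y ≤ x ᗮ with y + y ᗮ · x ᗮ = x ᗮ.
  orthogonal⇒sum : ∀ {x y} → IsIdempotent M x → x · y ≡ 𝟘 → x ⊕ y ≡ just (x ∨ y)
  orthogonal⇒sum {x} {y} x-idem xy≡0 =
    subst (λ w → x ⊕ y ≡ just w) (sym (∨-comm x-idem y)) (complement-shift y+yᗮxᗮ)
    where
    y·xᗮ≡y : y · (x ᗮ) ≡ y
    y·xᗮ≡y = ·ᗮ-stableʳ (trans (sym (idempotent-central x-idem y)) xy≡0)
    y+yᗮxᗮ : y ⊕ ((y ᗮ) · (x ᗮ)) ≡ just (x ᗮ)
    y+yᗮxᗮ = subst (λ w → w ⊕ ((y ᗮ) · (x ᗮ)) ≡ just (x ᗮ)) y·xᗮ≡y (splitʳ (x ᗮ) y)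

  module Boolean (all-idem : IsBoolean M) where

    isBooleanAlgebra : IsBooleanAlgebra _≡_ _∨_ _·_ _ᗮ 𝟙 𝟘
    isBooleanAlgebra = isBooleanAlgebraʳ record
      { isDistributiveLattice = isDistributiveLatticeʳʲᵐ record
        { isLattice = record
          { isEquivalence = isEquivalence
          ; ∨-comm        = λ x → ∨-comm (all-idem x)
          ; ∨-assoc       = ∨-assoc
          ; ∨-cong        = cong₂ _∨_
          ; ∧-comm        = λ x → idempotent-central (all-idem x)
          ; ∧-assoc       = ·-assoc
          ; ∧-cong        = cong₂ _·_
          ; absorptive    = (λ x → ∨-absorbs-· (all-idem x)) , (λ x → ·-absorbs-∨ (all-idem x))
          }
        ; ∨-distribʳ-∧ = λ x → ∨-distribʳ-· (all-idem x)
        }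
      ; ∨-complementʳ = λ x → ∨-complementʳ (all-idem x)
      ; ∧-complementʳ = λ x → ·ᗮ-zero (all-idem x)
      ; ¬-cong        = cong _ᗮ
      }

    undefined-sum : ∀ x y → ¬ (x · y ≡ 𝟘) → x ⊕ y ≡ nothing
    undefined-sum x y xy≢0 with x ⊕ y in xy
    ... | nothing = refl
    ... | just _  = ⊥-elim (xy≢0 (sum⇒orthogonal (all-idem x) xy))

    isBooleanAlgebraEM : IsBooleanAlgebraEM M
    isBooleanAlgebraEM =
        _∨_ , _·_ , _ᗮ , 𝟙 , 𝟘 , isBooleanAlgebra
      , (λ x y → orthogonal⇒sum (all-idem x)) , undefined-sum
      , (λ _ _ → refl) , refl , (λ _ → refl)

  booleanAlgebra⇒boolean : IsBooleanAlgebraEM M → IsBoolean M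
  booleanAlgebra⇒boolean (_ , _∧_ , _ , _ , _ , isBA , _ , _ , ·≡∧ , _) x =
    trans (·≡∧ x x) (LatticeProperties.∧-idem lattice x)
    where
    lattice : Lattice a a
    lattice = record { isLattice = IsBooleanAlgebra.isLattice isBA }

proposition45 : {a : Level} (M : EffectMonoid a) →
    PIsBooleanAlgebra M × ((IsBoolean M → IsBooleanAlgebraEM M) × (IsBooleanAlgebraEM M → IsBoolean M))
proposition45 M =
  P-isBooleanAlgebraM , Boolean.isBooleanAlgebraEM , booleanAlgebra⇒boolean
  where open EffectMonoidFacts M
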